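{- Let $f\in\{1,-1\}^{\mathbb{N}}$ be any folding instruction sequence, let $n\ge 7$, and let $k$ be the integer with $2^{k-1}<n\le 2^k$ (so $\phi(n)=2^k$). Then the factors $P_f[6\cdot2^k:6\cdot 2^k+n-1]$ and $P_f[6\cdot 2^k:6\cdot2^k+2^k-1]$ have their first occurrences in $P_f$ starting at the same index.
   Context: A folding instruction sequence is an infinite sequence $f=(f_0,f_1,\dots)$ with each $f_i\in\{1,-1\}$. The paper-folding sequence $P_f=P_f[1],P_f[2],\dots$ is defined by: for $m\ge1$ write $m=2^s r$ with $r$ odd; $P_f[m]=f_s$ if $r\equiv 1\pmod 4$ and $P_f[m]=-f_s$ if $r\equiv3\pmod4$. $P_f[i:j]$ denotes $P_f[i]P_f[i+1]\cdots P_f[j]$. The first occurrence of a word $w$ in $P_f$ is the least $i\ge1$ with $P_f[i:i+|w|-1]=w$. $\phi(n)$ is the least power of $2$ that is $\ge n$. -}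

module Defs where

open import Data.Nat using (ℕ; zero; suc; _+_; _*_; _^_; _≤_; _<_)
open import Data.Nat.DivMod using (_%_; _/_)
open import Data.Sign using (Sign; opposite)
open import Data.Product using (Σ; _×_)
open import Relation.Binary.PropositionalEquality using (_≡_)

-- A folding instruction sequence: f : ℕ → Sign  (Sign.+ ↔ 1, Sign.- ↔ -1).
FoldingSeq : Set
FoldingSeq = ℕ → Sign

-- 2-adic decomposition m = 2^s * r (r odd, for m ≥ 1), computed with fuel.
-- Returns (s , r).  With fuel ≥ m the result is exact for m ≥ 1.
decomp : ℕ → ℕ → ℕ × ℕ
decomp zero m = (0 Data.Product., m)
decomp (suc fuel) m with m % 2
... | suc _ = (0 Data.Product., m)
... | zero with m
...   | zero = (0 Data.Product., 0)
...   | suc m' with decomp fuel (suc m' / 2)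
...     | (s Data.Product., r) = (suc s Data.Product., r)

val2 : ℕ → ℕ
val2 m = Data.Product.proj₁ (decomp m m)

oddPart : ℕ → ℕ
oddPart m = Data.Product.proj₂ (decomp m m)

-- Paper-folding sequence P_f[m] (meaningful for m ≥ 1):
-- P_f[m] = f_s if r ≡ 1 (mod 4), and -f_s if r ≡ 3 (mod 4), where m = 2^s r.
P : FoldingSeq → ℕ → Sign
P f m with oddPart m % 4
... | 1 = f (val2 m)
... | _ = opposite (f (val2 m))

OccursAt : FoldingSeq → (a L i : ℕ) → Set
OccursAt f a L i = ∀ t → t < L → P f (i + t) ≡ P f (a + t)

FirstOcc : FoldingSeq → (a L i : ℕ) → Set
FirstOcc f a L i = (1 ≤ i) × OccursAt f a L i
                   × (∀ j → 1 ≤ j → j < i → OccursAt f a L j → Data.Empty.⊥)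
  where import Data.Empty

-- Write m = 2^s·(c + 4q) with c ∈ {1, 3}; then P_f[m] is f_s or -f_s according as c = 1 or 3.
-- Adding a multiple of 2^(K+1) to t < 2^K changes neither s nor c, so P_f[6·2^k + t] = P_f[t]
-- for 0 < t < 2^k, while P_f[6·2^k] = -f_(k+1). Let j be an occurrence of the length-n factor.
-- If j is odd, offsets 2 and 6 contradict P_f[2] = f_1, P_f[6] = -f_1; if j = 2^(s+1)·odd with
-- s < k, offset 2^s < n contradicts P_f[j + 2^s] = -f_s; if j = 2^(k+1)·(1 + 4q), offset 0
-- contradicts P_f[j] = f_(k+1). Every other j is at least 6·2^k, except j = 2^(k+2)·(1 + 4q) when
-- f_(k+2) = -f_(k+1), in which case 2^(k+2) is itself an occurrence of the length-2^k factor.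
-- So 6·2^k, resp. 2^(k+2), is the first occurrence of both factors.
{-# OPTIONS --safe #-}
module Submission where

open import Defs
open import Data.Nat
open import Data.Nat.Properties
open import Data.Nat.DivMod
open import Data.Nat.Induction using (<-wellFounded)
open import Data.Nat.Tactic.RingSolver using (solve-∀)
open import Data.Fin using (zero; suc)
open import Data.Product using (Σ; _×_; _,_; proj₁; proj₂)
open import Data.Sum using (_⊎_; inj₁; inj₂; [_,_]′)
open import Data.Sign using (Sign; opposite)
open import Data.Sign.Properties using (s≢opposite[s])
open import Data.Empty using (⊥-elim)
open import Function using (_∘_; id)
open import Induction.WellFounded using (Acc; acc)
open import Relation.Binary.PropositionalEquality
open import Relation.Nullary using (yes; no; ¬_)

decomp-double : ∀ fuel m s r → 0 < m → decomp fuel m ≡ (s , r) → decomp (suc fuel) (m * 2) ≡ (suc s , r)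
decomp-double fuel (suc m) s r _ eq rewrite m*n%n≡0 (suc m) 2 ⦃ _ ⦄ | m*n/n≡m (suc m) 2 ⦃ _ ⦄ | eq = refl

2^s*odd>0 : ∀ s r → r % 2 ≡ 1 → 0 < 2 ^ s * r
2^s*odd>0 s (suc r) _ = *-mono-≤ (m^n>0 2 s) (s≤s z≤n)

decomp-2^s*odd : ∀ fuel s r → r % 2 ≡ 1 → 2 ^ s * r ≤ fuel → decomp fuel (2 ^ s * r) ≡ (s , r)
decomp-2^s*odd zero s r odd ≤0 = ⊥-elim (<⇒≱ (2^s*odd>0 s r odd) ≤0)
decomp-2^s*odd (suc fuel) zero r odd _ rewrite +-identityʳ r | odd = refl
decomp-2^s*odd (suc fuel) (suc s) r odd ≤fuel = begin
  decomp (suc fuel) (2 ^ suc s * r) ≡⟨ cong (decomp (suc fuel)) 2^[1+s]*r≡x*2 ⟩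
  decomp (suc fuel) (x * 2)         ≡⟨ decomp-double fuel x s r x>0 (decomp-2^s*odd fuel s r odd x≤fuel) ⟩
  (suc s , r)                       ∎
  where
  open ≡-Reasoning
  x = 2 ^ s * r
  2^[1+s]*r≡x*2 : 2 ^ suc s * r ≡ x * 2
  2^[1+s]*r≡x*2 = trans (*-assoc 2 (2 ^ s) r) (*-comm 2 x)
  x>0 : 0 < x
  x>0 = 2^s*odd>0 s r odd
  x≤fuel : x ≤ fuel
  x≤fuel = s≤s⁻¹ (≤-trans (m<m*n x 2 {{>-nonZero x>0}} (s≤s (s≤s z≤n)))
                          (subst (_≤ suc fuel) 2^[1+s]*r≡x*2 ≤fuel))

val2-2^s*odd : ∀ s r → r % 2 ≡ 1 → val2 (2 ^ s * r) ≡ s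
val2-2^s*odd s r odd = cong proj₁ (decomp-2^s*odd _ s r odd ≤-refl)

oddPart-2^s*odd : ∀ s r → r % 2 ≡ 1 → oddPart (2 ^ s * r) ≡ r
oddPart-2^s*odd s r odd = cong proj₂ (decomp-2^s*odd _ s r odd ≤-refl)

[c+q*4]%2≡c%2 : ∀ c q → (c + q * 4) % 2 ≡ c % 2
[c+q*4]%2≡c%2 c q = trans (cong (λ x → (c + x) % 2) (sym (*-assoc q 2 2))) ([m+kn]%n≡m%n c (q * 2) 2)

P-oddPart≡1 : ∀ f m → oddPart m % 4 ≡ 1 → P f m ≡ f (val2 m)
P-oddPart≡1 f m eq rewrite eq = refl

P-oddPart≡3 : ∀ f m → oddPart m % 4 ≡ 3 → P f m ≡ opposite (f (val2 m))
P-oddPart≡3 f m eq rewrite eq = refl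

P-form₁ : ∀ f s q → P f (2 ^ s * (1 + q * 4)) ≡ f s
P-form₁ f s q = trans (P-oddPart≡1 f (2 ^ s * (1 + q * 4)) oddPart≡1) (cong f (val2-2^s*odd s _ odd))
  where
  odd : (1 + q * 4) % 2 ≡ 1
  odd = [c+q*4]%2≡c%2 1 q
  oddPart≡1 : oddPart (2 ^ s * (1 + q * 4)) % 4 ≡ 1
  oddPart≡1 = trans (cong (_% 4) (oddPart-2^s*odd s _ odd)) ([m+kn]%n≡m%n 1 q 4)

P-form₃ : ∀ f s q → P f (2 ^ s * (3 + q * 4)) ≡ opposite (f s)
P-form₃ f s q =
  trans (P-oddPart≡3 f (2 ^ s * (3 + q * 4)) oddPart≡3) (cong (opposite ∘ f) (val2-2^s*odd s _ odd))
  where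
  odd : (3 + q * 4) % 2 ≡ 1
  odd = [c+q*4]%2≡c%2 3 q
  oddPart≡3 : oddPart (2 ^ s * (3 + q * 4)) % 4 ≡ 3
  oddPart≡3 = trans (cong (_% 4) (oddPart-2^s*odd s _ odd)) ([m+kn]%n≡m%n 3 q 4)

data DyadicForm : ℕ → Set where
  form₁ : ∀ s q → DyadicForm (2 ^ s * (1 + q * 4))
  form₃ : ∀ s q → DyadicForm (2 ^ s * (3 + q * 4))

DyadicForm-double : ∀ {m} → DyadicForm m → DyadicForm (2 * m)
DyadicForm-double (form₁ s q) = subst DyadicForm (*-assoc 2 (2 ^ s) _) (form₁ (suc s) q)
DyadicForm-double (form₃ s q) = subst DyadicForm (*-assoc 2 (2 ^ s) _) (form₃ (suc s) q)

dyadicForm : ∀ m → 0 < m → DyadicForm m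
dyadicForm (suc m) _ = go m (<-wellFounded (suc m))
  where
  go : ∀ m → Acc _<_ (suc m) → DyadicForm (suc m)
  go m (acc rec) with suc m divMod 4
  ... | result (suc q) zero refl =
    subst DyadicForm (eq₀ q) (DyadicForm-double (go (suc (q * 2)) (rec (lt₀ q))))
    where
    eq₀ : ∀ q → 2 * (2 + q * 2) ≡ 4 + q * 4
    eq₀ = solve-∀
    lt₀ : ∀ q → 2 + q * 2 < 4 + q * 4
    lt₀ q = s≤s (s≤s (s≤s (m≤n⇒m≤1+n (*-monoʳ-≤ q (s≤s (s≤s z≤n))))))
  ... | result q (suc zero) refl = subst DyadicForm (*-identityˡ _) (form₁ 0 q)
  ... | result q (suc (suc zero)) refl =
    subst DyadicForm (eq₂ q) (DyadicForm-double (go (q * 2) (rec (lt₂ q))))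
    where
    eq₂ : ∀ q → 2 * (1 + q * 2) ≡ 2 + q * 4
    eq₂ = solve-∀
    lt₂ : ∀ q → 1 + q * 2 < 2 + q * 4
    lt₂ q = s≤s (s≤s (*-monoʳ-≤ q (s≤s (s≤s z≤n))))
  ... | result q (suc (suc (suc zero))) refl = subst DyadicForm (*-identityˡ _) (form₃ 0 q)

2^s*m<2^K⇒s<K : ∀ s m K → 0 < m → 2 ^ s * m < 2 ^ K → s < K
2^s*m<2^K⇒s<K s m K m>0 lt with s <? K
... | yes s<K = s<K
... | no s≮K = ⊥-elim (<⇒≱ lt (≤-trans (^-monoʳ-≤ 2 (≮⇒≥ s≮K)) (m≤m*n (2 ^ s) m {{>-nonZero m>0}})))

dyadic-shift : ∀ s d c r q →
               2 ^ suc (suc (s + d)) * q + 2 ^ s * (c + r * 4) ≡ 2 ^ s * (c + (r + 2 ^ d * q) * 4)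
dyadic-shift s d c r q rewrite ^-distribˡ-+-* 2 s d = identity (2 ^ s) (2 ^ d) c r q
  where
  identity : ∀ A B c r q → 2 * (2 * (A * B)) * q + A * (c + r * 4) ≡ A * (c + (r + B * q) * 4)
  identity = solve-∀

P-shift : ∀ f {X : Sign} K q s c r → s < K → (∀ r → P f (2 ^ s * (c + r * 4)) ≡ X) →
          P f (2 ^ suc K * q + 2 ^ s * (c + r * 4)) ≡ P f (2 ^ s * (c + r * 4))
P-shift f K q s c r s<K P≡X with m≤n⇒∃[o]m+o≡n s<K
... | d , refl = trans (cong (P f) (dyadic-shift s d c r q)) (trans (P≡X (r + 2 ^ d * q)) (sym (P≡X r)))

P-periodic : ∀ f K q t → 0 < t → t < 2 ^ K → P f (2 ^ suc K * q + t) ≡ P f t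
P-periodic f K q t t>0 t<2^K with dyadicForm t t>0
... | form₁ s r = P-shift f K q s 1 r (2^s*m<2^K⇒s<K s _ K z<s t<2^K) (P-form₁ f s)
... | form₃ s r = P-shift f K q s 3 r (2^s*m<2^K⇒s<K s _ K z<s t<2^K) (P-form₃ f s)

OccursAt-shorten : ∀ f a {L M} i → L ≤ M → OccursAt f a M i → OccursAt f a L i
OccursAt-shorten f a i L≤M occ t t<L = occ t (<-≤-trans t<L L≤M)

OccursAt⇒P≡ : ∀ f a {L} i → 0 < L → OccursAt f a L i → P f i ≡ P f a
OccursAt⇒P≡ f a i L>0 occ = begin
  P f i       ≡⟨ cong (P f) (+-identityʳ i) ⟨
  P f (i + 0) ≡⟨ occ 0 L>0 ⟩
  P f (a + 0) ≡⟨ cong (P f) (+-identityʳ a) ⟩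
  P f a       ∎
  where open ≡-Reasoning

FirstOcc-shared : ∀ f a {L M} i → L ≤ M → 0 < i → OccursAt f a M i →
                  (∀ j → 0 < j → OccursAt f a L j → i ≤ j) → FirstOcc f a L i × FirstOcc f a M i
FirstOcc-shared f a i L≤M i>0 occ least =
  (i>0 , OccursAt-shorten f a i L≤M occ , λ j j>0 j<i occ′ → <⇒≱ j<i (least j j>0 occ′)) ,
  (i>0 , occ , λ j j>0 j<i occ′ → <⇒≱ j<i (least j j>0 (OccursAt-shorten f a j L≤M occ′)))

P[4r+1+2]≡P[4r+1+6] : ∀ f r → P f (2 ^ 0 * (1 + r * 4) + 2) ≡ P f (2 ^ 0 * (1 + r * 4) + 6)
P[4r+1+2]≡P[4r+1+6] f r = begin
  P f (2 ^ 0 * (1 + r * 4) + 2)       ≡⟨ cong (P f) (+2 r) ⟩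
  P f (2 ^ 0 * (3 + r * 4))           ≡⟨ P-form₃ f 0 r ⟩
  opposite (f 0)                      ≡⟨ P-form₃ f 0 (r + 1) ⟨
  P f (2 ^ 0 * (3 + (r + 1) * 4))     ≡⟨ cong (P f) (+6 r) ⟨
  P f (2 ^ 0 * (1 + r * 4) + 6)       ∎
  where
  open ≡-Reasoning
  +2 : ∀ r → 2 ^ 0 * (1 + r * 4) + 2 ≡ 2 ^ 0 * (3 + r * 4)
  +2 = solve-∀
  +6 : ∀ r → 2 ^ 0 * (1 + r * 4) + 6 ≡ 2 ^ 0 * (3 + (r + 1) * 4)
  +6 = solve-∀

P[4r+3+2]≡P[4r+3+6] : ∀ f r → P f (2 ^ 0 * (3 + r * 4) + 2) ≡ P f (2 ^ 0 * (3 + r * 4) + 6)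
P[4r+3+2]≡P[4r+3+6] f r = begin
  P f (2 ^ 0 * (3 + r * 4) + 2)       ≡⟨ cong (P f) (+2 r) ⟩
  P f (2 ^ 0 * (1 + (r + 1) * 4))     ≡⟨ P-form₁ f 0 (r + 1) ⟩
  f 0                                 ≡⟨ P-form₁ f 0 (r + 2) ⟨
  P f (2 ^ 0 * (1 + (r + 2) * 4))     ≡⟨ cong (P f) (+6 r) ⟨
  P f (2 ^ 0 * (3 + r * 4) + 6)       ∎
  where
  open ≡-Reasoning
  +2 : ∀ r → 2 ^ 0 * (3 + r * 4) + 2 ≡ 2 ^ 0 * (1 + (r + 1) * 4)
  +2 = solve-∀
  +6 : ∀ r → 2 ^ 0 * (3 + r * 4) + 6 ≡ 2 ^ 0 * (1 + (r + 2) * 4)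
  +6 = solve-∀

P[2^[1+s]*[1+4r]+2^s]≡-f[s] : ∀ f s r → P f (2 ^ suc s * (1 + r * 4) + 2 ^ s) ≡ opposite (f s)
P[2^[1+s]*[1+4r]+2^s]≡-f[s] f s r = trans (cong (P f) (identity (2 ^ s) r)) (P-form₃ f s (r * 2))
  where
  identity : ∀ A r → 2 * A * (1 + r * 4) + A ≡ A * (3 + r * 2 * 4)
  identity = solve-∀

P[2^[1+s]*[3+4r]+2^s]≡-f[s] : ∀ f s r → P f (2 ^ suc s * (3 + r * 4) + 2 ^ s) ≡ opposite (f s)
P[2^[1+s]*[3+4r]+2^s]≡-f[s] f s r = trans (cong (P f) (identity (2 ^ s) r)) (P-form₃ f s (1 + r * 2))
  where
  identity : ∀ A r → 2 * A * (3 + r * 4) + A ≡ A * (3 + (1 + r * 2) * 4)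
  identity = solve-∀

2^m*c≤2^n*[c+r*4] : ∀ {m n} c r → m ≤ n → 2 ^ m * c ≤ 2 ^ n * (c + r * 4)
2^m*c≤2^n*[c+r*4] c r m≤n = *-mono-≤ (^-monoʳ-≤ 2 m≤n) (m≤m+n c (r * 4))

module _ (f : FoldingSeq) (k : ℕ) where

  a : ℕ
  a = 6 * 2 ^ k

  a≡2^[1+k]*3 : a ≡ 2 ^ suc k * 3
  a≡2^[1+k]*3 = identity (2 ^ k)
    where
    identity : ∀ A → 6 * A ≡ 2 * A * 3
    identity = solve-∀

  a≤2^[3+k] : a ≤ 2 ^ (3 + k) * 1
  a≤2^[3+k] = subst (a ≤_) (identity (2 ^ k)) (*-monoˡ-≤ (2 ^ k) (m≤m+n 6 2))
    where
    identity : ∀ A → 8 * A ≡ 2 * (2 * (2 * A)) * 1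
    identity = solve-∀

  P-a : P f a ≡ opposite (f (suc k))
  P-a = trans (cong (P f) a≡2^[1+k]*3) (P-form₃ f (suc k) 0)

  P-a+t : ∀ t → 0 < t → t < 2 ^ k → P f (a + t) ≡ P f t
  P-a+t t t>0 t<2^k = trans (cong (λ x → P f (x + t)) a≡2^[1+k]*3) (P-periodic f k 3 t t>0 t<2^k)

  no-occurrence-at-odd : ∀ {L} j → 6 < L → 6 < 2 ^ k → P f (j + 2) ≡ P f (j + 6) → ¬ OccursAt f a L j
  no-occurrence-at-odd j 6<L 6<2^k P[j+2]≡P[j+6] occ = s≢opposite[s] (f 1) (begin
    f 1           ≡⟨ P-a+t 2 z<s (<-trans (s≤s (s≤s (s≤s z≤n))) 6<2^k) ⟨
    P f (a + 2)   ≡⟨ occ 2 (<-trans (s≤s (s≤s (s≤s z≤n))) 6<L) ⟨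
    P f (j + 2)   ≡⟨ P[j+2]≡P[j+6] ⟩
    P f (j + 6)   ≡⟨ occ 6 6<L ⟩
    P f (a + 6)   ≡⟨ P-a+t 6 z<s 6<2^k ⟩
    opposite (f 1) ∎)
    where open ≡-Reasoning

  no-occurrence-below : ∀ {L} j s → s < k → 2 ^ s < L → P f (j + 2 ^ s) ≡ opposite (f s) →
                        ¬ OccursAt f a L j
  no-occurrence-below j s s<k 2^s<L P[j+2^s]≡-f[s] occ = s≢opposite[s] (f s) (begin
    f s               ≡⟨ P-form₁ f s 0 ⟨
    P f (2 ^ s * 1)   ≡⟨ cong (P f) (*-identityʳ (2 ^ s)) ⟩
    P f (2 ^ s)       ≡⟨ P-a+t (2 ^ s) (m^n>0 2 s) (^-monoʳ-< 2 (s≤s (s≤s z≤n)) s<k) ⟨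
    P f (a + 2 ^ s)   ≡⟨ occ (2 ^ s) 2^s<L ⟨
    P f (j + 2 ^ s)   ≡⟨ P[j+2^s]≡-f[s] ⟩
    opposite (f s)    ∎)
    where open ≡-Reasoning

  LateEnough : ℕ → Set
  LateEnough j = a ≤ j ⊎ (f (2 + k) ≡ opposite (f (1 + k)) × 2 ^ (2 + k) ≤ j)

  LateEnough-2^[1+s]*[1+4r] : ∀ s r → k ≤ s → f (suc s) ≡ opposite (f (suc k)) →
                              LateEnough (2 ^ suc s * (1 + r * 4))
  LateEnough-2^[1+s]*[1+4r] s r k≤s f[1+s]≡-f[1+k] with k ≟ s
  ... | yes refl = ⊥-elim (s≢opposite[s] _ f[1+s]≡-f[1+k])
  ... | no k≢s with suc k ≟ s
  ...   | yes refl = inj₂ (f[1+s]≡-f[1+k] , m≤m*n (2 ^ suc s) (1 + r * 4))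
  ...   | no 1+k≢s = inj₁ (≤-trans a≤2^[3+k] (2^m*c≤2^n*[c+r*4] 1 r (s≤s 2+k≤s)))
    where
    2+k≤s : 2 + k ≤ s
    2+k≤s = ≤∧≢⇒< (≤∧≢⇒< k≤s k≢s) 1+k≢s

  2^[2+k]≤a : 2 ^ (2 + k) ≤ a
  2^[2+k]≤a = subst (_≤ a) (identity (2 ^ k)) (*-monoˡ-≤ (2 ^ k) (m≤m+n 4 2))
    where
    identity : ∀ A → 4 * A ≡ 2 * (2 * A)
    identity = solve-∀

  2^[2+k]-occurs : f (2 + k) ≡ opposite (f (1 + k)) → OccursAt f a (2 ^ k) (2 ^ (2 + k))
  2^[2+k]-occurs f[2+k]≡-f[1+k] zero _ = begin
    P f (2 ^ (2 + k) + 0)         ≡⟨ cong (P f) (+-identityʳ (2 ^ (2 + k))) ⟩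
    P f (2 ^ (2 + k))             ≡⟨ cong (P f) (*-identityʳ (2 ^ (2 + k))) ⟨
    P f (2 ^ (2 + k) * 1)         ≡⟨ P-form₁ f (2 + k) 0 ⟩
    f (2 + k)                     ≡⟨ f[2+k]≡-f[1+k] ⟩
    opposite (f (1 + k))          ≡⟨ P-a ⟨
    P f a                         ≡⟨ cong (P f) (+-identityʳ a) ⟨
    P f (a + 0)                   ∎
    where open ≡-Reasoning
  2^[2+k]-occurs _ t@(suc _) t<2^k = begin
    P f (2 ^ (2 + k) + t)         ≡⟨ cong (λ x → P f (x + t)) (identity (2 ^ k)) ⟩
    P f (2 ^ suc k * 2 + t)       ≡⟨ P-periodic f k 2 t z<s t<2^k ⟩
    P f t                         ≡⟨ P-a+t t z<s t<2^k ⟨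
    P f (a + t)                   ∎
    where
    open ≡-Reasoning
    identity : ∀ A → 2 * (2 * A) ≡ 2 * A * 2
    identity = solve-∀

  module _ {L} (7≤L : 7 ≤ L) (2^[k-1]<L : 2 ^ (k ∸ 1) < L) (L≤2^k : L ≤ 2 ^ k) where

    6<2^k : 6 < 2 ^ k
    6<2^k = ≤-trans 7≤L L≤2^k

    2^s<L : ∀ {s} → s < k → 2 ^ s < L
    2^s<L s<k = ≤-<-trans (^-monoʳ-≤ 2 (∸-monoˡ-≤ 1 s<k)) 2^[k-1]<L

    occurrence-bound : ∀ j → 0 < j → OccursAt f a L j → LateEnough j
    occurrence-bound j j>0 occ with dyadicForm j j>0
    ... | form₁ zero r =
      ⊥-elim (no-occurrence-at-odd (2 ^ 0 * (1 + r * 4)) 7≤L 6<2^k (P[4r+1+2]≡P[4r+1+6] f r) occ)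
    ... | form₃ zero r =
      ⊥-elim (no-occurrence-at-odd (2 ^ 0 * (3 + r * 4)) 7≤L 6<2^k (P[4r+3+2]≡P[4r+3+6] f r) occ)
    ... | form₁ (suc s) r with s <? k
    ...   | yes s<k = ⊥-elim (no-occurrence-below (2 ^ suc s * (1 + r * 4)) s s<k (2^s<L s<k)
                                                (P[2^[1+s]*[1+4r]+2^s]≡-f[s] f s r) occ)
    ...   | no s≮k = LateEnough-2^[1+s]*[1+4r] s r (≮⇒≥ s≮k) (begin
      f (suc s)                      ≡⟨ P-form₁ f (suc s) r ⟨
      P f (2 ^ suc s * (1 + r * 4))  ≡⟨ OccursAt⇒P≡ f a (2 ^ suc s * (1 + r * 4)) (<-≤-trans z<s 7≤L) occ ⟩
      P f a                          ≡⟨ P-a ⟩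
      opposite (f (suc k))           ∎)
      where open ≡-Reasoning
    occurrence-bound j j>0 occ | form₃ (suc s) r with s <? k
    ...   | yes s<k = ⊥-elim (no-occurrence-below (2 ^ suc s * (3 + r * 4)) s s<k (2^s<L s<k)
                                                (P[2^[1+s]*[3+4r]+2^s]≡-f[s] f s r) occ)
    ...   | no s≮k = inj₁ (subst (_≤ 2 ^ suc s * (3 + r * 4)) (sym a≡2^[1+k]*3)
                                 (2^m*c≤2^n*[c+r*4] 3 r (s≤s (≮⇒≥ s≮k))))

    least-occurrence : Σ ℕ λ i → 0 < i × OccursAt f a (2 ^ k) i ×
                                 (∀ j → 0 < j → OccursAt f a L j → i ≤ j)
    least-occurrence with f (2 + k) Data.Sign.≟ opposite (f (1 + k))
    ... | no f[2+k]≢-f[1+k] = a , *-mono-≤ (s≤s (z≤n {5})) (m^n>0 2 k) , (λ _ _ → refl) , λ j j>0 occ →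
      [ id , (λ early → ⊥-elim (f[2+k]≢-f[1+k] (proj₁ early))) ]′ (occurrence-bound j j>0 occ)
    ... | yes f[2+k]≡-f[1+k] = 2 ^ (2 + k) , m^n>0 2 (2 + k) , 2^[2+k]-occurs f[2+k]≡-f[1+k] , λ j j>0 occ →
      [ ≤-trans 2^[2+k]≤a , proj₂ ]′ (occurrence-bound j j>0 occ)

lemma3p3 : (f : FoldingSeq) (n k : ℕ) → 7 ≤ n → 2 ^ (k ∸ 1) < n → n ≤ 2 ^ k →
    Σ ℕ (λ i → FirstOcc f (6 * 2 ^ k) n i × FirstOcc f (6 * 2 ^ k) (2 ^ k) i)
lemma3p3 f n k 7≤n 2^[k-1]<n n≤2^k with least-occurrence f k 7≤n 2^[k-1]<n n≤2^k
... | i , i>0 , occ , least = i , FirstOcc-shared f (6 * 2 ^ k) i n≤2^k i>0 occ least
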